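{- Let $G$ be a nut graph whose vertex set is partitioned into the $\mathrm{Aut}(G)$-orbits $V(G) = \mathcal{V}_1 \sqcup \cdots \sqcup \mathcal{V}_k$, and let $\mathbf{x} = [x_1\ \ldots\ x_n]^\intercal$ be a non-zero vector in $\ker \mathbf{A}(G)$. Suppose that every orbit $\mathcal{V}_\ell$ is an independent set in $G$ and that the vertex-orbit graph $\mathfrak{G}(G)$ is a cycle of odd length. Then for every orbit $\mathcal{V}_i$ we have $\sum_{j \in \mathcal{V}_i} x_j = 0$; moreover, for every orbit $\mathcal{V}_i$, $|\{ j \in \mathcal{V}_i : x_j > 0 \}| = |\{ j \in \mathcal{V}_i : x_j < 0 \}|$, and $|\mathcal{V}_i|$ is even.
   Context: All graphs are finite, simple and connected. A nut graph is a graph $G$ whose adjacency matrix $\mathbf{A}(G)$ has one-dimensional kernel spanned by a vector with no zero entry ($K_1$ excluded as trivial). $\mathrm{Aut}(G)$ is the full automorphism group. The vertex-orbit graph $\mathfrak{G}(G)$ is the simple graph whose vertices are the vertex orbits of $\mathrm{Aut}(G)$, with two distinct orbits adjacent iff $G$ has at least one edge joining a vertex of one to a vertex of the other.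
   Formalization: The kernel vector $\mathbf{x}$ has rational entries, and the kernel of $\mathbf{A}(G)$ in the definition of a nut graph is taken over ℚ. -}

module Defs where

open import Data.Nat using (ℕ; zero; suc; _≤_; _+_; _*_)
open import Data.Fin using (Fin; zero; suc; _≟_; toℕ)
open import Data.Nat.DivMod using (_%_)
open import Data.Fin.Permutation using (Permutation′; _⟨$⟩ʳ_)
open import Data.Bool using (Bool; true; false; if_then_else_; _∧_)
open import Data.Rational as ℚ using (ℚ; 0ℚ)
open import Data.Rational.Properties as ℚP using ()
open import Data.Product using (Σ; ∃; _×_; _,_)
open import Data.Sum using (_⊎_)
open import Relation.Nullary using (¬_)
open import Relation.Nullary.Decidable using (⌊_⌋)
open import Relation.Binary.PropositionalEquality using (_≡_; _≢_)
open import Relation.Binary.Construct.Closure.ReflexiveTransitive using (Star)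

record Graph (n : ℕ) : Set where
  field
    adj   : Fin n → Fin n → Bool
    sym   : ∀ u v → adj u v ≡ adj v u
    irref : ∀ u → adj u u ≡ false
open Graph public

Edge : ∀ {n} → Graph n → Fin n → Fin n → Set
Edge G u v = adj G u v ≡ true

Connected : ∀ {n} → Graph n → Set
Connected G = ∀ u v → Star (Edge G) u v

Σℚ : ∀ {n} → (Fin n → ℚ) → ℚ
Σℚ {zero}  f = 0ℚ
Σℚ {suc n} f = f zero ℚ.+ Σℚ (λ i → f (suc i))

Σℕ : ∀ {n} → (Fin n → ℕ) → ℕ
Σℕ {zero}  f = 0
Σℕ {suc n} f = f zero + Σℕ (λ i → f (suc i))

mulAdj : ∀ {n} → Graph n → (Fin n → ℚ) → Fin n → ℚ
mulAdj G x u = Σℚ (λ v → if adj G u v then x v else 0ℚ)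

InKernel : ∀ {n} → Graph n → (Fin n → ℚ) → Set
InKernel G x = ∀ u → mulAdj G x u ≡ 0ℚ

IsNut : ∀ {n} → Graph n → Set
IsNut {n} G =
  2 ≤ n × Connected G ×
  Σ (Fin n → ℚ) (λ z →
      (∀ u → z u ≢ 0ℚ) × InKernel G z ×
      (∀ y → InKernel G y → ∃ λ c → ∀ u → y u ≡ c ℚ.* z u))

IsAut : ∀ {n} → Graph n → Permutation′ n → Set
IsAut G σ = ∀ u v → adj G (σ ⟨$⟩ʳ u) (σ ⟨$⟩ʳ v) ≡ adj G u v

SameOrbit : ∀ {n} → Graph n → Fin n → Fin n → Set
SameOrbit G u v = Σ _ (λ σ → IsAut G σ × (σ ⟨$⟩ʳ u) ≡ v)

CycAdj : ∀ {k} → Fin k → Fin k → Set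
CycAdj {zero} ()
CycAdj {suc k'} i j = let k = suc k' in (toℕ j ≡ (toℕ i + 1) % k) ⊎ (toℕ i ≡ (toℕ j + 1) % k)

-- The vertex-orbit graph of G is (isomorphic to) a cycle of odd length k = 2m+3:
-- o labels each vertex by its orbit, bijectively between orbits and Fin k,
-- and two distinct orbits are adjacent in the orbit graph iff consecutive mod k.
OrbitGraphOddCycle : ∀ {n} → Graph n → (k : ℕ) → (Fin n → Fin k) → Set
OrbitGraphOddCycle {n} G k o =
  (∃ λ m → k ≡ 2 * m + 3) ×
  (∀ i → ∃ λ u → o u ≡ i) ×
  (∀ u v → (o u ≡ o v → SameOrbit G u v) × (SameOrbit G u v → o u ≡ o v)) ×
  (∀ i j → i ≢ j →
     ((∃ λ u → ∃ λ v → Edge G u v × o u ≡ i × o v ≡ j) → CycAdj i j) ×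
     (CycAdj i j → ∃ λ u → ∃ λ v → Edge G u v × o u ≡ i × o v ≡ j))

orbitSum : ∀ {n k} → (Fin n → Fin k) → (Fin n → ℚ) → Fin k → ℚ
orbitSum o x i = Σℚ (λ u → if ⌊ o u ≟ i ⌋ then x u else 0ℚ)

orbitSize : ∀ {n k} → (Fin n → Fin k) → Fin k → ℕ
orbitSize o i = Σℕ (λ u → if ⌊ o u ≟ i ⌋ then 1 else 0)

orbitPos : ∀ {n k} → (Fin n → Fin k) → (Fin n → ℚ) → Fin k → ℕ
orbitPos o x i = Σℕ (λ u → if ⌊ o u ≟ i ⌋ ∧ ⌊ 0ℚ ℚP.<? x u ⌋ then 1 else 0)

orbitNeg : ∀ {n k} → (Fin n → Fin k) → (Fin n → ℚ) → Fin k → ℕ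
orbitNeg o x i = Σℕ (λ u → if ⌊ o u ≟ i ⌋ ∧ ⌊ x u ℚP.<? 0ℚ ⌋ then 1 else 0)

-- Every automorphism σ maps ker A(G) to itself, and the kernel is spanned by the nowhere-zero
-- vector x, so x ∘ σ = c · x for a scalar c ≠ 0. If c < 0 for some σ, then σ fixes every orbit
-- setwise while flipping every sign of x: each orbit sum equals c times itself, hence vanishes,
-- and σ matches the positive entries of an orbit with its negative ones. Otherwise x has constant
-- sign on each orbit. A vertex of orbit j + 1 has neighbours only in orbits j and j + 2 (orbits
-- are independent and the orbit graph is a cycle), at least one in orbit j, and the kernel
-- equation at that vertex forbids all of them to have the same sign; so the orbit signs
-- alternate along every second step of the cycle, which is impossible on an odd cycle.
module Submission where

open import Defs hiding (sym)
open import Data.Nat using (ℕ; _*_)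
open import Data.Fin using (Fin)
open import Data.Rational using (ℚ; 0ℚ)
open import Data.Product using (∃; _×_)
open import Relation.Binary.PropositionalEquality using (_≡_; _≢_)
open import Relation.Nullary using (¬_)

open import Algebra.Bundles using (CommutativeRing)
import Algebra.Properties.CommutativeMonoid.Sum as CommutativeMonoidSum
import Algebra.Properties.Semiring.Sum as SemiringSum
open import Data.Bool using (Bool; true; false; not; if_then_else_; _∧_)
open import Data.Bool.Properties using (not-involutive; not-¬; ¬-not; if-float; if-cong; if-cong-then; if-cong-else)
open import Data.Empty using (⊥)
open import Data.Fin using (zero; suc; toℕ; _≟_)
open import Data.Fin.Permutation using (Permutation′; _⟨$⟩ʳ_)
import Data.Fin.Properties as FinP
open import Data.Nat as ℕ using (zero; suc; _+_; _≤_; _<_; s≤s)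
open import Data.Nat.DivMod using (_%_; _mod_; %-distribˡ-+; m%n%n≡m%n; [m+n]%n≡m%n; m<n⇒m%n≡m; n%n≡0; m*n%n≡0; m%n<n)
import Data.Nat.Properties as ℕP
open import Data.Nat.Tactic.RingSolver using (solve-∀)
open import Data.Product using (_,_; proj₁; proj₂)
open import Data.Rational as ℚ using (1/_; ≢-nonZero; positive; negative)
import Data.Rational.Properties as ℚP
open import Data.Sum using (_⊎_; inj₁; inj₂; fromInj₁)
open import Function using (_⇔_; mk⇔)
open import Relation.Binary using (tri<; tri≈; tri>)
open import Relation.Binary.PropositionalEquality using (refl; sym; trans; cong; cong₂; subst; module ≡-Reasoning)
open import Relation.Nullary using (Dec; yes; no; contradiction)
open import Relation.Nullary.Decidable using (⌊_⌋; _×-dec_; decidable-stable; isYes≗does; does-⇔)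

private
  module ΣQ = SemiringSum (CommutativeRing.semiring ℚP.+-*-commutativeRing)
  module ΣN = CommutativeMonoidSum ℕP.+-0-commutativeMonoid

  Σℚ≡sum : ∀ {n} (f : Fin n → ℚ) → Σℚ f ≡ ΣQ.sum f
  Σℚ≡sum {zero}  f = refl
  Σℚ≡sum {suc n} f = cong (f zero ℚ.+_) (Σℚ≡sum (λ i → f (suc i)))

  Σℕ≡sum : ∀ {n} (f : Fin n → ℕ) → Σℕ f ≡ ΣN.sum f
  Σℕ≡sum {zero}  f = refl
  Σℕ≡sum {suc n} f = cong (f zero +_) (Σℕ≡sum (λ i → f (suc i)))

Σℚ-cong : ∀ {n} {f g : Fin n → ℚ} → (∀ u → f u ≡ g u) → Σℚ f ≡ Σℚ g
Σℚ-cong {f = f} {g} f≗g = trans (Σℚ≡sum f) (trans (ΣQ.sum-cong-≗ f≗g) (sym (Σℚ≡sum g)))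

Σℕ-cong : ∀ {n} {f g : Fin n → ℕ} → (∀ u → f u ≡ g u) → Σℕ f ≡ Σℕ g
Σℕ-cong {f = f} {g} f≗g = trans (Σℕ≡sum f) (trans (ΣN.sum-cong-≗ f≗g) (sym (Σℕ≡sum g)))

Σℚ-permute : ∀ {n} (f : Fin n → ℚ) (σ : Permutation′ n) → Σℚ (λ u → f (σ ⟨$⟩ʳ u)) ≡ Σℚ f
Σℚ-permute f σ = trans (Σℚ≡sum (λ u → f (σ ⟨$⟩ʳ u))) (trans (sym (ΣQ.sum-permute f σ)) (sym (Σℚ≡sum f)))

Σℕ-permute : ∀ {n} (f : Fin n → ℕ) (σ : Permutation′ n) → Σℕ (λ u → f (σ ⟨$⟩ʳ u)) ≡ Σℕ f
Σℕ-permute f σ = trans (Σℕ≡sum (λ u → f (σ ⟨$⟩ʳ u))) (trans (sym (ΣN.sum-permute f σ)) (sym (Σℕ≡sum f)))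

Σℕ-distrib-+ : ∀ {n} (f g : Fin n → ℕ) → Σℕ (λ u → f u + g u) ≡ Σℕ f + Σℕ g
Σℕ-distrib-+ f g =
  trans (Σℕ≡sum (λ u → f u + g u)) (trans (ΣN.∑-distrib-+ f g) (sym (cong₂ _+_ (Σℕ≡sum f) (Σℕ≡sum g))))

*-distribˡ-Σℚ : ∀ {n} (c : ℚ) (f : Fin n → ℚ) → c ℚ.* Σℚ f ≡ Σℚ (λ u → c ℚ.* f u)
*-distribˡ-Σℚ c f =
  trans (cong (c ℚ.*_) (Σℚ≡sum f)) (trans (ΣQ.*-distribˡ-sum c f) (sym (Σℚ≡sum (λ u → c ℚ.* f u))))

Σℚ-nonNeg : ∀ {n} {f : Fin n → ℚ} → (∀ u → 0ℚ ℚ.≤ f u) → 0ℚ ℚ.≤ Σℚ f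
Σℚ-nonNeg {zero}  f≥0 = ℚP.≤-refl
Σℚ-nonNeg {suc n} f≥0 = ℚP.+-mono-≤ (f≥0 zero) (Σℚ-nonNeg (λ i → f≥0 (suc i)))

Σℚ-pos : ∀ {n} {f : Fin n → ℚ} → (∀ u → 0ℚ ℚ.≤ f u) → ∀ w → 0ℚ ℚ.< f w → 0ℚ ℚ.< Σℚ f
Σℚ-pos f≥0 zero    fw>0 = ℚP.+-mono-<-≤ fw>0 (Σℚ-nonNeg (λ i → f≥0 (suc i)))
Σℚ-pos f≥0 (suc w) fw>0 = ℚP.+-mono-≤-< (f≥0 zero) (Σℚ-pos (λ i → f≥0 (suc i)) w fw>0)

isPositive : ℚ → Bool
isPositive q = ⌊ 0ℚ ℚP.<? q ⌋

isNegative : ℚ → Bool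
isNegative q = ⌊ q ℚP.<? 0ℚ ⌋

⌊⌋-⇔ : ∀ {a b} {A : Set a} {B : Set b} → A ⇔ B → (a? : Dec A) (b? : Dec B) → ⌊ a? ⌋ ≡ ⌊ b? ⌋
⌊⌋-⇔ A⇔B a? b? = trans (isYes≗does a?) (trans (does-⇔ A⇔B a? b?) (sym (isYes≗does b?)))

≢0∧≯0⇒<0 : ∀ {q} → q ≢ 0ℚ → ¬ (0ℚ ℚ.< q) → q ℚ.< 0ℚ
≢0∧≯0⇒<0 {q} q≢0 q≯0 with ℚP.<-cmp q 0ℚ
... | tri< q<0 _ _ = q<0
... | tri≈ _ q≡0 _ = contradiction q≡0 q≢0
... | tri> _ _ q>0 = contradiction q>0 q≯0

isNegative≡not-isPositive : ∀ {q} → q ≢ 0ℚ → isNegative q ≡ not (isPositive q)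
isNegative≡not-isPositive {q} q≢0 with 0ℚ ℚP.<? q | q ℚP.<? 0ℚ
... | yes q>0 | yes q<0 = contradiction q<0 (ℚP.<-asym q>0)
... | yes _   | no _    = refl
... | no _    | yes _   = refl
... | no q≯0  | no q≮0  = contradiction (≢0∧≯0⇒<0 q≢0 q≯0) q≮0

isPositive≡⇒0<* : ∀ {p q} → p ≢ 0ℚ → q ≢ 0ℚ → isPositive p ≡ isPositive q → 0ℚ ℚ.< p ℚ.* q
isPositive≡⇒0<* {p} {q} p≢0 q≢0 same with 0ℚ ℚP.<? p | 0ℚ ℚP.<? q
... | yes p>0 | yes q>0 =
  ℚP.positive⁻¹ (p ℚ.* q) {{ℚP.pos*pos⇒pos p {{positive p>0}} q {{positive q>0}}}}
... | no p≯0 | no q≯0 =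
  ℚP.positive⁻¹ (p ℚ.* q)
    {{ℚP.neg*neg⇒pos p {{negative (≢0∧≯0⇒<0 p≢0 p≯0)}} q {{negative (≢0∧≯0⇒<0 q≢0 q≯0)}}}}
... | yes _ | no _ = contradiction same λ ()
... | no _ | yes _ = contradiction same λ ()

isPositive-*-pos : ∀ {c} q → 0ℚ ℚ.< c → isPositive (c ℚ.* q) ≡ isPositive q
isPositive-*-pos {c} q c>0 = ⌊⌋-⇔ (mk⇔ cancel mono) (0ℚ ℚP.<? c ℚ.* q) (0ℚ ℚP.<? q)
  where
  instance
    c-pos : ℚ.Positive c
    c-pos = positive c>0
    c-nonNeg : ℚ.NonNegative c
    c-nonNeg = ℚP.pos⇒nonNeg c
  cancel : 0ℚ ℚ.< c ℚ.* q → 0ℚ ℚ.< q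
  cancel cq>0 = ℚP.*-cancelˡ-<-nonNeg c (subst (ℚ._< c ℚ.* q) (sym (ℚP.*-zeroʳ c)) cq>0)
  mono : 0ℚ ℚ.< q → 0ℚ ℚ.< c ℚ.* q
  mono q>0 = subst (ℚ._< c ℚ.* q) (ℚP.*-zeroʳ c) (ℚP.*-monoʳ-<-pos c q>0)

isPositive-*-neg : ∀ {c} q → c ℚ.< 0ℚ → isPositive (c ℚ.* q) ≡ isNegative q
isPositive-*-neg {c} q c<0 = ⌊⌋-⇔ (mk⇔ cancel mono) (0ℚ ℚP.<? c ℚ.* q) (q ℚP.<? 0ℚ)
  where
  instance
    c-neg : ℚ.Negative c
    c-neg = negative c<0
    c-nonPos : ℚ.NonPositive c
    c-nonPos = ℚP.neg⇒nonPos c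
  cancel : 0ℚ ℚ.< c ℚ.* q → q ℚ.< 0ℚ
  cancel cq>0 = ℚP.*-cancelˡ-<-nonPos c (subst (ℚ._< c ℚ.* q) (sym (ℚP.*-zeroʳ c)) cq>0)
  mono : q ℚ.< 0ℚ → 0ℚ ℚ.< c ℚ.* q
  mono q<0 = subst (ℚ._< c ℚ.* q) (ℚP.*-zeroʳ c) (ℚP.*-monoʳ-<-neg c q<0)

neg-*-fixed⇒≡0 : ∀ {c q} → c ℚ.< 0ℚ → c ℚ.* q ≡ q → q ≡ 0ℚ
neg-*-fixed⇒≡0 {c} {q} c<0 cq≡q with q ℚ.≟ 0ℚ
... | yes q≡0 = q≡0
... | no q≢0  = contradiction sign-flips (not-¬ refl)
  where
  open ≡-Reasoning
  sign-flips : isPositive q ≡ not (isPositive q)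
  sign-flips = begin
    isPositive q           ≡⟨ cong isPositive cq≡q ⟨
    isPositive (c ℚ.* q)   ≡⟨ isPositive-*-neg q c<0 ⟩
    isNegative q           ≡⟨ isNegative≡not-isPositive q≢0 ⟩
    not (isPositive q)     ∎

1/p*[p*q]≡q : ∀ p .{{_ : ℚ.NonZero p}} q → 1/ p ℚ.* (p ℚ.* q) ≡ q
1/p*[p*q]≡q p q = begin
  1/ p ℚ.* (p ℚ.* q)  ≡⟨ ℚP.*-assoc (1/ p) p q ⟨
  1/ p ℚ.* p ℚ.* q    ≡⟨ cong (ℚ._* q) (ℚP.*-inverseˡ p) ⟩
  ℚ.1ℚ ℚ.* q          ≡⟨ ℚP.*-identityˡ q ⟩
  q                   ∎
  where open ≡-Reasoning

*-≢0 : ∀ {p q} → p ≢ 0ℚ → q ≢ 0ℚ → p ℚ.* q ≢ 0ℚ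
*-≢0 {p} {q} p≢0 q≢0 pq≡0 = q≢0 (begin
  q                    ≡⟨ 1/p*[p*q]≡q p q ⟨
  1/ p ℚ.* (p ℚ.* q)   ≡⟨ cong (1/ p ℚ.*_) pq≡0 ⟩
  1/ p ℚ.* 0ℚ          ≡⟨ ℚP.*-zeroʳ (1/ p) ⟩
  0ℚ                   ∎)
  where
  open ≡-Reasoning
  instance
    p-nonZero : ℚ.NonZero p
    p-nonZero = ≢-nonZero p≢0

*-distribˡ-if-0 : ∀ c b {q} → c ℚ.* (if b then q else 0ℚ) ≡ (if b then c ℚ.* q else 0ℚ)
*-distribˡ-if-0 c b = trans (if-float (c ℚ.*_) b) (if-cong-else b (ℚP.*-zeroʳ c))

kernel-∘-aut : ∀ {n} (G : Graph n) {σ x} → IsAut G σ → InKernel G x → InKernel G (λ u → x (σ ⟨$⟩ʳ u))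
kernel-∘-aut G {σ} {x} aut kx u = begin
  Σℚ (λ v → if adj G u v then x (σ ⟨$⟩ʳ v) else 0ℚ)
    ≡⟨ Σℚ-cong (λ v → if-cong (aut u v)) ⟨
  Σℚ (λ v → if adj G (σ ⟨$⟩ʳ u) (σ ⟨$⟩ʳ v) then x (σ ⟨$⟩ʳ v) else 0ℚ)
    ≡⟨ Σℚ-permute (λ v → if adj G (σ ⟨$⟩ʳ u) v then x v else 0ℚ) σ ⟩
  mulAdj G x (σ ⟨$⟩ʳ u)
    ≡⟨ kx (σ ⟨$⟩ʳ u) ⟩
  0ℚ ∎
  where open ≡-Reasoning

kernel-neighbourhood-not-one-signed : ∀ {n} (G : Graph n) {x u v} → InKernel G x → Edge G u v →
  ¬ (∀ w → Edge G u w → 0ℚ ℚ.< x v ℚ.* x w)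
kernel-neighbourhood-not-one-signed {n} G {x} {u} {v} kx uv one-signed =
  ℚP.<-irrefl (sym weighted-sum≡0) (Σℚ-pos term-nonNeg v term-v-pos)
  where
  term : Fin n → ℚ
  term w = if adj G u w then x v ℚ.* x w else 0ℚ

  weighted-sum≡0 : Σℚ term ≡ 0ℚ
  weighted-sum≡0 = begin
    Σℚ term                      ≡⟨ Σℚ-cong (λ w → *-distribˡ-if-0 (x v) (adj G u w)) ⟨
    Σℚ (λ w → x v ℚ.* (if adj G u w then x w else 0ℚ))
                                 ≡⟨ *-distribˡ-Σℚ (x v) (λ w → if adj G u w then x w else 0ℚ) ⟨
    x v ℚ.* mulAdj G x u         ≡⟨ cong (x v ℚ.*_) (kx u) ⟩
    x v ℚ.* 0ℚ                   ≡⟨ ℚP.*-zeroʳ (x v) ⟩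
    0ℚ                           ∎
    where open ≡-Reasoning

  term-nonNeg : ∀ w → 0ℚ ℚ.≤ term w
  term-nonNeg w with adj G u w in uw
  ... | true  = ℚP.<⇒≤ (one-signed w uw)
  ... | false = ℚP.≤-refl

  term-v-pos : 0ℚ ℚ.< term v
  term-v-pos rewrite uv = one-signed v uv

record KernelGenerator {n} (G : Graph n) (x : Fin n → ℚ) : Set where
  field
    nowhereZero : ∀ u → x u ≢ 0ℚ
    spans       : ∀ y → InKernel G y → ∃ λ c → ∀ u → y u ≡ c ℚ.* x u

nut⇒kernelGenerator : ∀ {n} (G : Graph n) {x u₀} → IsNut G → InKernel G x → x u₀ ≢ 0ℚ →
  KernelGenerator G x
nut⇒kernelGenerator G {x} {u₀} (_ , _ , z , z≢0 , _ , z-spans) kx xu₀≢0 = record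
  { nowhereZero = λ u xu≡0 → *-≢0 c≢0 (z≢0 u) (trans (sym (x≡cz u)) xu≡0)
  ; spans       = spans
  }
  where
  open ≡-Reasoning
  c : ℚ
  c = proj₁ (z-spans x kx)
  x≡cz : ∀ u → x u ≡ c ℚ.* z u
  x≡cz = proj₂ (z-spans x kx)

  c≢0 : c ≢ 0ℚ
  c≢0 c≡0 = xu₀≢0 (begin
    x u₀            ≡⟨ x≡cz u₀ ⟩
    c ℚ.* z u₀      ≡⟨ cong (ℚ._* z u₀) c≡0 ⟩
    0ℚ ℚ.* z u₀     ≡⟨ ℚP.*-zeroˡ (z u₀) ⟩
    0ℚ              ∎)

  instance
    c-nonZero : ℚ.NonZero c
    c-nonZero = ≢-nonZero c≢0

  spans : ∀ y → InKernel G y → ∃ λ c → ∀ u → y u ≡ c ℚ.* x u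
  spans y ky with z-spans y ky
  ... | d , y≡dz = d ℚ.* 1/ c , λ u → begin
    y u                           ≡⟨ y≡dz u ⟩
    d ℚ.* z u                     ≡⟨ cong (d ℚ.*_) (1/p*[p*q]≡q c (z u)) ⟨
    d ℚ.* (1/ c ℚ.* (c ℚ.* z u))  ≡⟨ cong (λ t → d ℚ.* (1/ c ℚ.* t)) (x≡cz u) ⟨
    d ℚ.* (1/ c ℚ.* x u)          ≡⟨ ℚP.*-assoc d (1/ c) (x u) ⟨
    d ℚ.* 1/ c ℚ.* x u            ∎

Balanced : ∀ {n k} → (Fin n → Fin k) → (Fin n → ℚ) → Fin k → Set
Balanced o x i = orbitSum o x i ≡ 0ℚ × orbitPos o x i ≡ orbitNeg o x i

balanced? : ∀ {n k} (o : Fin n → Fin k) (x : Fin n → ℚ) (i : Fin k) → Dec (Balanced o x i)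
balanced? o x i = orbitSum o x i ℚ.≟ 0ℚ ×-dec orbitPos o x i ℕ.≟ orbitNeg o x i

orbitSize≡orbitPos+orbitNeg : ∀ {n k} (o : Fin n → Fin k) {x : Fin n → ℚ} → (∀ u → x u ≢ 0ℚ) →
  ∀ i → orbitSize o i ≡ orbitPos o x i + orbitNeg o x i
orbitSize≡orbitPos+orbitNeg {n} o {x} x≢0 i =
  trans (Σℕ-cong split-at) (Σℕ-distrib-+ (λ u → indicator (inOrbit u ∧ isPositive (x u)))
                                          (λ u → indicator (inOrbit u ∧ isNegative (x u))))
  where
  inOrbit : Fin n → Bool
  inOrbit u = ⌊ o u ≟ i ⌋

  indicator : Bool → ℕ
  indicator b = if b then 1 else 0

  split : ∀ b s → indicator b ≡ indicator (b ∧ s) + indicator (b ∧ not s)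
  split true  true  = refl
  split true  false = refl
  split false _     = refl

  split-at : ∀ u → indicator (inOrbit u)
                   ≡ indicator (inOrbit u ∧ isPositive (x u)) + indicator (inOrbit u ∧ isNegative (x u))
  split-at u rewrite isNegative≡not-isPositive (x≢0 u) = split (inOrbit u) (isPositive (x u))

module _ {n k} {o : Fin n → Fin k} {σ : Permutation′ n} (o∘σ≗o : ∀ u → o (σ ⟨$⟩ʳ u) ≡ o u) where

  orbitSum-∘ : ∀ x i → orbitSum o (λ u → x (σ ⟨$⟩ʳ u)) i ≡ orbitSum o x i
  orbitSum-∘ x i = trans (Σℚ-cong (λ u → if-cong (cong (λ j → ⌊ j ≟ i ⌋) (sym (o∘σ≗o u)))))
                         (Σℚ-permute (λ u → if ⌊ o u ≟ i ⌋ then x u else 0ℚ) σ)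

  orbitPos-∘ : ∀ x i → orbitPos o (λ u → x (σ ⟨$⟩ʳ u)) i ≡ orbitPos o x i
  orbitPos-∘ x i =
    trans (Σℕ-cong (λ u → if-cong (cong (λ j → ⌊ j ≟ i ⌋ ∧ isPositive (x (σ ⟨$⟩ʳ u))) (sym (o∘σ≗o u)))))
          (Σℕ-permute (λ u → if ⌊ o u ≟ i ⌋ ∧ isPositive (x u) then 1 else 0) σ)

  negative-scaling⇒balanced : ∀ {x c} → c ℚ.< 0ℚ → (∀ u → x (σ ⟨$⟩ʳ u) ≡ c ℚ.* x u) → ∀ i → Balanced o x i
  negative-scaling⇒balanced {x} {c} c<0 x∘σ≗cx i = neg-*-fixed⇒≡0 c<0 sum-fixed , pos≡neg
    where
    open ≡-Reasoning
    sum-fixed : c ℚ.* orbitSum o x i ≡ orbitSum o x i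
    sum-fixed = begin
      c ℚ.* orbitSum o x i
        ≡⟨ *-distribˡ-Σℚ c (λ u → if ⌊ o u ≟ i ⌋ then x u else 0ℚ) ⟩
      Σℚ (λ u → c ℚ.* (if ⌊ o u ≟ i ⌋ then x u else 0ℚ))
        ≡⟨ Σℚ-cong (λ u → trans (*-distribˡ-if-0 c ⌊ o u ≟ i ⌋) (if-cong-then ⌊ o u ≟ i ⌋ (sym (x∘σ≗cx u)))) ⟩
      orbitSum o (λ u → x (σ ⟨$⟩ʳ u)) i
        ≡⟨ orbitSum-∘ x i ⟩
      orbitSum o x i ∎

    pos≡neg : orbitPos o x i ≡ orbitNeg o x i
    pos≡neg = begin
      orbitPos o x i
        ≡⟨ orbitPos-∘ x i ⟨
      orbitPos o (λ u → x (σ ⟨$⟩ʳ u)) i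
        ≡⟨ Σℕ-cong (λ u → cong (λ b → if ⌊ o u ≟ i ⌋ ∧ b then 1 else 0)
                               (trans (cong isPositive (x∘σ≗cx u)) (isPositive-*-neg (x u) c<0))) ⟩
      orbitNeg o x i ∎

[m%d+n]%d≡[m+n]%d : ∀ m n d .{{_ : ℕ.NonZero d}} → (m % d + n) % d ≡ (m + n) % d
[m%d+n]%d≡[m+n]%d m n d = trans (%-distribˡ-+ (m % d) n d)
  (trans (cong (λ t → (t + n % d) % d) (m%n%n≡m%n m d)) (sym (%-distribˡ-+ m n d)))

+1-mod-injective : ∀ {k} a b → (a + 1) % suc k ≡ (b + 1) % suc k → a % suc k ≡ b % suc k
+1-mod-injective {k} a b e =
  trans (sym (add-predecessor a)) (trans (cong (λ t → (t + k) % suc k) e) (add-predecessor b))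
  where
  add-predecessor : ∀ m → ((m + 1) % suc k + k) % suc k ≡ m % suc k
  add-predecessor m = trans ([m%d+n]%d≡[m+n]%d (m + 1) k (suc k))
    (trans (cong (_% suc k) (ℕP.+-assoc m 1 k)) ([m+n]%n≡m%n m (suc k)))

[r+1]%n≢r : ∀ {r n} .{{_ : ℕ.NonZero n}} → 2 ≤ n → r < n → (r + 1) % n ≢ r
[r+1]%n≢r {r} {n} 2≤n r<n e with ℕP.m≤n⇒m<n∨m≡n (subst (_≤ n) (ℕP.+-comm 1 r) r<n)
... | inj₁ r+1<n = ℕP.1+n≢n (trans (ℕP.+-comm 1 r) (trans (sym (m<n⇒m%n≡m r+1<n)) e))
... | inj₂ r+1≡n = contradiction (subst (2 ≤_) n≡1 2≤n) λ { (s≤s ()) }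
  where
  r≡0 : r ≡ 0
  r≡0 = trans (sym e) (trans (cong (_% n) r+1≡n) (n%n≡0 n))
  n≡1 : n ≡ 1
  n≡1 = trans (sym r+1≡n) (cong (_+ 1) r≡0)

module _ {k : ℕ} where

  toℕ-mod : ∀ j → toℕ (j mod suc k) ≡ j % suc k
  toℕ-mod j = FinP.toℕ-fromℕ< (m%n<n j (suc k))

  toℕ-suc-mod : ∀ j → toℕ (suc j mod suc k) ≡ (toℕ (j mod suc k) + 1) % suc k
  toℕ-suc-mod j = begin
    toℕ (suc j mod suc k)              ≡⟨ toℕ-mod (suc j) ⟩
    suc j % suc k                      ≡⟨ cong (_% suc k) (ℕP.+-comm 1 j) ⟩
    (j + 1) % suc k                    ≡⟨ [m%d+n]%d≡[m+n]%d j 1 (suc k) ⟨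
    (j % suc k + 1) % suc k            ≡⟨ cong (λ t → (t + 1) % suc k) (toℕ-mod j) ⟨
    (toℕ (j mod suc k) + 1) % suc k    ∎
    where open ≡-Reasoning

  suc-mod≢mod : 2 ≤ suc k → ∀ j → suc j mod suc k ≢ j mod suc k
  suc-mod≢mod 2≤K j e =
    [r+1]%n≢r 2≤K (FinP.toℕ<n (j mod suc k)) (trans (sym (toℕ-suc-mod j)) (cong toℕ e))

  cycAdj-suc-mod-mod : ∀ j → CycAdj (suc j mod suc k) (j mod suc k)
  cycAdj-suc-mod-mod j = inj₂ (toℕ-suc-mod j)

  cycAdj-suc-mod⇒ : ∀ j {w} → CycAdj (suc j mod suc k) w → w ≡ j mod suc k ⊎ w ≡ suc (suc j) mod suc k
  cycAdj-suc-mod⇒ j (inj₁ e) = inj₂ (FinP.toℕ-injective (trans e (sym (toℕ-suc-mod (suc j)))))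
  cycAdj-suc-mod⇒ j {w} (inj₂ e) = inj₁ (FinP.toℕ-injective (begin
    toℕ w                   ≡⟨ m<n⇒m%n≡m (FinP.toℕ<n w) ⟨
    toℕ w % suc k           ≡⟨ +1-mod-injective (toℕ w) (toℕ (j mod suc k)) (trans (sym e) (toℕ-suc-mod j)) ⟩
    toℕ (j mod suc k) % suc k ≡⟨ m<n⇒m%n≡m (FinP.toℕ<n (j mod suc k)) ⟩
    toℕ (j mod suc k)       ∎))
    where open ≡-Reasoning

module _ {g : ℕ → Bool} (g-alternates : ∀ j → g (2 + j) ≡ not (g j)) where

  alternating-period-4 : ∀ m j → g (m * 4 + j) ≡ g j
  alternating-period-4 zero    j = refl
  alternating-period-4 (suc m) j = begin
    g (2 + (2 + (m * 4 + j)))  ≡⟨ g-alternates (2 + (m * 4 + j)) ⟩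
    not (g (2 + (m * 4 + j)))  ≡⟨ cong not (g-alternates (m * 4 + j)) ⟩
    not (not (g (m * 4 + j)))  ≡⟨ not-involutive _ ⟩
    g (m * 4 + j)              ≡⟨ alternating-period-4 m j ⟩
    g j                        ∎
    where open ≡-Reasoning

  alternating-odd : ∀ m → g (2 * (2 * m + 1)) ≡ not (g 0)
  alternating-odd m = begin
    g (2 * (2 * m + 1))  ≡⟨ cong g (2[2m+1]≡m*4+2 m) ⟩
    g (m * 4 + 2)        ≡⟨ alternating-period-4 m 2 ⟩
    g 2                  ≡⟨ g-alternates 0 ⟩
    not (g 0)            ∎
    where
    open ≡-Reasoning
    2[2m+1]≡m*4+2 : ∀ m → 2 * (2 * m + 1) ≡ m * 4 + 2
    2[2m+1]≡m*4+2 = solve-∀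

module OddOrbitCycle
  {n k} {G : Graph n} {o : Fin n → Fin (suc k)} (og : OrbitGraphOddCycle G (suc k) o)
  (orbits-independent : ∀ u v → Edge G u v → ¬ SameOrbit G u v)
  {x : Fin n → ℚ} (kx : InKernel G x) (gen : KernelGenerator G x) where

  open KernelGenerator gen

  private
    K : ℕ
    K = suc k

    m : ℕ
    m = proj₁ (proj₁ og)

    K≡2m+3 : K ≡ 2 * m + 3
    K≡2m+3 = proj₂ (proj₁ og)

    o-surjective : ∀ i → ∃ λ u → o u ≡ i
    o-surjective = proj₁ (proj₂ og)

    o≡⇒sameOrbit : ∀ u v → o u ≡ o v → SameOrbit G u v
    o≡⇒sameOrbit u v = proj₁ (proj₁ (proj₂ (proj₂ og)) u v)

    sameOrbit⇒o≡ : ∀ u v → SameOrbit G u v → o u ≡ o v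
    sameOrbit⇒o≡ u v = proj₂ (proj₁ (proj₂ (proj₂ og)) u v)

    orbitEdge⇒cycAdj : ∀ i j → i ≢ j → (∃ λ u → ∃ λ v → Edge G u v × o u ≡ i × o v ≡ j) → CycAdj i j
    orbitEdge⇒cycAdj i j i≢j = proj₁ (proj₂ (proj₂ (proj₂ og)) i j i≢j)

    cycAdj⇒orbitEdge : ∀ i j → i ≢ j → CycAdj i j → ∃ λ u → ∃ λ v → Edge G u v × o u ≡ i × o v ≡ j
    cycAdj⇒orbitEdge i j i≢j = proj₂ (proj₂ (proj₂ (proj₂ og)) i j i≢j)

    2≤K : 2 ≤ K
    2≤K = subst (2 ≤_) (sym K≡2m+3) (ℕP.≤-trans (ℕP.n≤1+n 2) (ℕP.m≤n+m 3 (2 * m)))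

  o-aut-invariant : ∀ {σ} → IsAut G σ → ∀ u → o (σ ⟨$⟩ʳ u) ≡ o u
  o-aut-invariant {σ} aut u = sym (sameOrbit⇒o≡ u (σ ⟨$⟩ʳ u) (σ , aut , refl))

  aut-preserves-signs-or-balanced : ∀ {σ} → IsAut G σ →
    (∀ u → isPositive (x (σ ⟨$⟩ʳ u)) ≡ isPositive (x u)) ⊎ (∀ i → Balanced o x i)
  aut-preserves-signs-or-balanced {σ} aut with spans (λ u → x (σ ⟨$⟩ʳ u)) (kernel-∘-aut G {σ} aut kx)
  ... | c , x∘σ≗cx with ℚP.<-cmp c 0ℚ
  ... | tri< c<0 _ _ = inj₂ (negative-scaling⇒balanced {σ = σ} (o-aut-invariant {σ} aut) c<0 x∘σ≗cx)
  ... | tri≈ _ c≡0 _ = inj₁ λ u →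
    contradiction (trans (x∘σ≗cx u) (trans (cong (ℚ._* x u) c≡0) (ℚP.*-zeroˡ (x u)))) (nowhereZero (σ ⟨$⟩ʳ u))
  ... | tri> _ _ c>0 = inj₁ λ u → trans (cong isPositive (x∘σ≗cx u)) (isPositive-*-pos (x u) c>0)

  edge-to-previous-orbit : ∀ j → ∃ λ u → ∃ λ v → Edge G u v × o u ≡ suc j mod K × o v ≡ j mod K
  edge-to-previous-orbit j = cycAdj⇒orbitEdge _ _ (suc-mod≢mod 2≤K j) (cycAdj-suc-mod-mod j)

  neighbour-orbits : ∀ j {u w} → o u ≡ suc j mod K → Edge G u w → o w ≡ j mod K ⊎ o w ≡ suc (suc j) mod K
  neighbour-orbits j {u} {w} ou uw =
    cycAdj-suc-mod⇒ j (subst (λ i → CycAdj i (o w)) ou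
      (orbitEdge⇒cycAdj (o u) (o w) ou≢ow (u , w , uw , refl , refl)))
    where
    ou≢ow : o u ≢ o w
    ou≢ow ou≡ow = orbits-independent u w uw (o≡⇒sameOrbit u w ou≡ow)

  module _ (preserved : ∀ σ → IsAut G σ → ∀ u → isPositive (x (σ ⟨$⟩ʳ u)) ≡ isPositive (x u)) where

    orbitSign : Fin K → Bool
    orbitSign i = isPositive (x (proj₁ (o-surjective i)))

    isPositive≡orbitSign : ∀ u → isPositive (x u) ≡ orbitSign (o u)
    isPositive≡orbitSign u with o≡⇒sameOrbit (proj₁ (o-surjective (o u))) u (proj₂ (o-surjective (o u)))
    ... | σ , aut , σr≡u = trans (cong (λ w → isPositive (x w)) (sym σr≡u)) (preserved σ aut _)

    orbitSign-not-repeated : ∀ j → orbitSign (suc (suc j) mod K) ≢ orbitSign (j mod K)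
    orbitSign-not-repeated j same with edge-to-previous-orbit j
    ... | u , v , uv , ou , ov = kernel-neighbourhood-not-one-signed G kx uv λ w uw →
      isPositive≡⇒0<* (nowhereZero v) (nowhereZero w)
        (trans (sign v (inj₁ ov)) (sym (sign w (neighbour-orbits j ou uw))))
      where
      sign : ∀ w → o w ≡ j mod K ⊎ o w ≡ suc (suc j) mod K → isPositive (x w) ≡ orbitSign (j mod K)
      sign w (inj₁ ow) = trans (isPositive≡orbitSign w) (cong orbitSign ow)
      sign w (inj₂ ow) = trans (isPositive≡orbitSign w) (trans (cong orbitSign ow) same)

    signs-not-all-preserved : ⊥
    signs-not-all-preserved = not-¬ refl (begin
      g 0                        ≡⟨ cong orbitSign 2K-mod-K≡0-mod-K ⟨
      g (2 * K)                  ≡⟨ cong (λ t → g (2 * t)) K≡2[m+1]+1 ⟩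
      g (2 * (2 * suc m + 1))    ≡⟨ alternating-odd (λ j → ¬-not (orbitSign-not-repeated j)) (suc m) ⟩
      not (g 0)                  ∎)
      where
      open ≡-Reasoning
      g : ℕ → Bool
      g j = orbitSign (j mod K)
      2K-mod-K≡0-mod-K : 2 * K mod K ≡ 0 mod K
      2K-mod-K≡0-mod-K =
        FinP.toℕ-injective (trans (toℕ-mod (2 * K)) (trans (m*n%n≡0 2 K) (sym (toℕ-mod {k} 0))))
      K≡2[m+1]+1 : K ≡ 2 * suc m + 1
      K≡2[m+1]+1 = trans K≡2m+3 (2m+3≡2[m+1]+1 m)
        where
        2m+3≡2[m+1]+1 : ∀ m → 2 * m + 3 ≡ 2 * suc m + 1
        2m+3≡2[m+1]+1 = solve-∀

proposition8 : ∀ {n} (G : Graph n) → IsNut G →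
    (k : ℕ) (o : Fin n → Fin k) → OrbitGraphOddCycle G k o →
    (∀ u v → Edge G u v → ¬ SameOrbit G u v) →
    (x : Fin n → ℚ) → (∃ λ u → x u ≢ 0ℚ) → InKernel G x →
    ∀ i → orbitSum o x i ≡ 0ℚ
        × orbitPos o x i ≡ orbitNeg o x i
        × ∃ λ m → orbitSize o i ≡ 2 * m
proposition8 G nut zero    o og indep x x≢0 kx ()
proposition8 G nut (suc k) o og indep x (u₀ , xu₀≢0) kx i =
  proj₁ balanced , proj₂ balanced , orbitPos o x i , size≡2pos
  where
  gen : KernelGenerator G x
  gen = nut⇒kernelGenerator G nut kx xu₀≢0
  open OddOrbitCycle og indep kx gen

  -- No sign-reversing automorphism can be exhibited, but Balanced is decidable, so it is
  -- enough to refute its negation.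
  balanced : Balanced o x i
  balanced = decidable-stable (balanced? o x i) λ ¬balanced →
    signs-not-all-preserved λ σ aut →
      fromInj₁ (λ all-balanced → contradiction (all-balanced i) ¬balanced)
               (aut-preserves-signs-or-balanced {σ} aut)

  size≡2pos : orbitSize o i ≡ 2 * orbitPos o x i
  size≡2pos = trans (orbitSize≡orbitPos+orbitNeg o (KernelGenerator.nowhereZero gen) i)
    (cong (orbitPos o x i +_) (trans (sym (proj₂ balanced)) (sym (ℕP.+-identityʳ (orbitPos o x i)))))
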